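{- For every $n\ge 3$, $\gamma_{\rm MB}(C_n)=\gamma_{\rm MB}'(C_n)=\left\lfloor \frac{n}{2}\right\rfloor$, where $C_n$ is the cycle on $n$ vertices.
   Context: The Maker-Breaker domination game on a graph: Dominator and Staller alternately select a vertex not selected before; Dominator wins if at some point his selected vertices form a dominating set, Staller wins otherwise. In the D-game Dominator moves first, in the S-game Staller moves first. $\gamma_{\rm MB}(G)$ (resp. $\gamma_{\rm MB}'(G)$) is the minimum $k$ such that Dominator has a strategy in the D-game (resp. S-game) guaranteeing that his selected vertices dominate $G$ after at most $k$ of his moves, whatever Staller does, and is $\infty$ if he has no winning strategy. -}

module Defs where

open import Data.Nat using (ℕ; zero; suc; _∸_)
open import Data.Fin using (Fin; toℕ)
open import Data.Fin.Subset using (Subset; _∈_; _∉_; _∪_; ⁅_⁆; ⊥)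
open import Data.Product using (Σ; ∃; _×_)
open import Data.Sum using (_⊎_)
open import Relation.Binary.PropositionalEquality using (_≡_)
open import Relation.Nullary using (¬_)

-- A (finite, simple, undirected) graph on vertex set Fin n is given by its
-- adjacency relation; only the closed neighbourhoods matter for domination.
Graph : ℕ → Set₁
Graph n = Fin n → Fin n → Set

Cycle : (n : ℕ) → Graph n
Cycle n i j =
  (toℕ j ≡ suc (toℕ i)) ⊎ (toℕ i ≡ suc (toℕ j)) ⊎
  ((toℕ i ≡ 0 × toℕ j ≡ n ∸ 1) ⊎ (toℕ j ≡ 0 × toℕ i ≡ n ∸ 1))

Dominating : ∀ {n} → Graph n → Subset n → Set
Dominating {n} G D = ∀ (u : Fin n) → ∃ λ v → v ∈ D × (v ≡ u ⊎ G v u)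

Free : ∀ {n} → Subset n → Subset n → Fin n → Set
Free D S v = v ∉ D × v ∉ S

-- Positions of the Maker-Breaker domination game: D = Dominator's vertices,
-- S = Staller's vertices.
mutual
  data DTurn {n} (G : Graph n) : ℕ → Subset n → Subset n → Set where
    d-done : ∀ {k D S} → Dominating G D → DTurn G k D S
    d-move : ∀ {k D S} (v : Fin n) → Free D S v →
             STurn G k (D ∪ ⁅ v ⁆) S → DTurn G (suc k) D S

  data STurn {n} (G : Graph n) : ℕ → Subset n → Subset n → Set where
    s-done : ∀ {k D S} → Dominating G D → STurn G k D S
    s-move : ∀ {k D S} → ∃ (Free D S) →
             (∀ v → Free D S v → DTurn G k D (S ∪ ⁅ v ⁆)) → STurn G k D S

IsLeast : (ℕ → Set) → ℕ → Set
IsLeast P k = P k × (∀ j → P j → k Data.Nat.≤ j)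

γMB≡ : ∀ {n} → Graph n → ℕ → Set
γMB≡ G k = IsLeast (λ j → DTurn G j ⊥ ⊥) k

γMB'≡ : ∀ {n} → Graph n → ℕ → Set
γMB'≡ G k = IsLeast (λ j → STurn G j ⊥ ⊥) k

-- Upper bounds come from pairing strategies for Dominator. Suppose the pairs are
-- disjoint and every vertex is dominated by Dominator's set or by both vertices of
-- some pair. Dominator answers a Staller move inside an untouched pair by its
-- partner, and otherwise claims a vertex of some untouched pair; every round closes
-- a pair. Pairing {2i, 2i+1} handles the S-game on C_{2p}. After Dominator claims
-- a vertex c, the vertices c+2, …, c+2m+1 can be paired and c dominates the rest
-- when n ≤ 2m + 3; this gives the D-game, and the S-game on odd cycles once
-- Dominator answers Staller's first vertex by its successor.
--
-- Lower bounds come from a pairing strategy for Staller with pairs {2i, 2i+3}. As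
-- long as Dominator never owns both vertices of a pair, a dominating set of his
-- must meet every block {2i+1, 2i+2} (and, for odd n, the closed neighbourhood of
-- n − 1). The blocks are disjoint, so each of his moves meets at most one new block.

module Submission where

open import Defs
open import Data.Nat
  using (ℕ; zero; suc; pred; _+_; _*_; _∸_; _≤_; _<_; _≤?_; _<?_; z≤n; s≤s; _%_; _/_; NonZero; >-nonZero⁻¹)
open import Data.Nat.DivMod
open import Data.Nat.Divisibility using (divides)
open import Data.Nat.Properties hiding (_≟_)
open import Data.Fin using (Fin; toℕ; _≟_)
open import Data.Fin.Properties using (toℕ-fromℕ<; toℕ-injective; toℕ<n)
open import Data.Fin.Subset using (Subset; _∈_; _∉_; _∪_; ⁅_⁆; ⊥)
open import Data.Fin.Subset.Properties using (_∈?_; ∉⊥; x∈⁅x⁆; x∈⁅y⁆⇒x≡y; x∈p∪q⁻; x∈p∪q⁺)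
open import Data.Product using (∃; _×_; _,_; proj₁; proj₂)
open import Data.Sum using (_⊎_; inj₁; inj₂; map₁)
open import Data.Empty using (⊥-elim)
open import Relation.Nullary using (¬_; Dec; yes; no; ¬?)
open import Relation.Nullary.Decidable using (_×-dec_; _⊎-dec_)
open import Relation.Unary using (Pred; Decidable)
open import Function using (_∘_)
open import Data.List using (List; []; _∷_)
open import Data.List.Relation.Unary.Any as Any using (Any; here; there; any?)
open import Data.List.Relation.Unary.Any.Properties using (Any-⊎⁻)
open import Data.List.Membership.Propositional using () renaming (_∈_ to _∈ˡ_)
open import Relation.Binary.PropositionalEquality

module _ {n} {p : Subset n} {x y : Fin n} where

  ∈-∪⁅⁆⁻ : x ∈ p ∪ ⁅ y ⁆ → x ∈ p ⊎ x ≡ y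
  ∈-∪⁅⁆⁻ x∈ with x∈p∪q⁻ p ⁅ y ⁆ x∈
  ... | inj₁ x∈p = inj₁ x∈p
  ... | inj₂ x∈y = inj₂ (x∈⁅y⁆⇒x≡y y x∈y)

  ∈-∪⁅⁆ˡ : x ∈ p → x ∈ p ∪ ⁅ y ⁆
  ∈-∪⁅⁆ˡ x∈p = x∈p∪q⁺ (inj₁ x∈p)

  ∉-∪⁅⁆ : x ∉ p → x ≢ y → x ∉ p ∪ ⁅ y ⁆
  ∉-∪⁅⁆ x∉p x≢y x∈ with ∈-∪⁅⁆⁻ x∈
  ... | inj₁ x∈p = x∉p x∈p
  ... | inj₂ x≡y = x≢y x≡y

∈-∪⁅⁆ʳ : ∀ {n} {p : Subset n} y → y ∈ p ∪ ⁅ y ⁆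
∈-∪⁅⁆ʳ y = x∈p∪q⁺ (inj₂ (x∈⁅x⁆ y))

count : ∀ {ℓ} {P : Pred ℕ ℓ} → Decidable P → ℕ → ℕ
count P? zero = zero
count P? (suc k) with P? k
... | yes _ = suc (count P? k)
... | no _ = count P? k

below-suc : ∀ {ℓ} {X : Pred ℕ ℓ} {k} → (∀ {i} → i < suc k → X i) → ∀ {i} → i < k → X i
below-suc h i<k = h (m<n⇒m<1+n i<k)

module _ {ℓ} {P : Pred ℕ ℓ} (P? : Decidable P) where

  count-≤ : ∀ k → count P? k ≤ k
  count-≤ zero = z≤n
  count-≤ (suc k) with P? k
  ... | yes _ = s≤s (count-≤ k)
  ... | no _ = m≤n⇒m≤1+n (count-≤ k)

  count-all : ∀ k → (∀ {i} → i < k → P i) → count P? k ≡ k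
  count-all zero _ = refl
  count-all (suc k) all with P? k
  ... | yes _ = cong suc (count-all k (below-suc all))
  ... | no ¬Pk = ⊥-elim (¬Pk (all (n<1+n k)))

  count-pos : ∀ k {j} → j < k → P j → 0 < count P? k
  count-pos (suc k) j<1+k Pj with P? k | m<1+n⇒m<n∨m≡n j<1+k
  ... | yes _ | _ = s≤s z≤n
  ... | no _ | inj₁ j<k = count-pos k j<k Pj
  ... | no ¬Pk | inj₂ refl = ⊥-elim (¬Pk Pj)

  count-none : ∀ k → (∀ {i} → i < k → ¬ P i) → count P? k ≡ 0
  count-none zero _ = refl
  count-none (suc k) none with P? k
  ... | yes Pk = ⊥-elim (none (n<1+n k) Pk)
  ... | no _ = count-none k (below-suc none)

module _ {ℓ} {P Q : Pred ℕ ℓ} (P? : Decidable P) (Q? : Decidable Q) where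

  count-mono : ∀ k → (∀ {i} → i < k → P i → Q i) → count P? k ≤ count Q? k
  count-mono zero _ = z≤n
  count-mono (suc k) P⇒Q with P? k | Q? k
  ... | yes _ | yes _ = s≤s (count-mono k (below-suc P⇒Q))
  ... | yes Pk | no ¬Qk = ⊥-elim (¬Qk (P⇒Q (n<1+n k) Pk))
  ... | no _ | yes _ = m≤n⇒m≤1+n (count-mono k (below-suc P⇒Q))
  ... | no _ | no _ = count-mono k (below-suc P⇒Q)

  count-mono-< : ∀ k {j} → (∀ {i} → i < k → P i → Q i) →
                 j < k → Q j → ¬ P j → count P? k < count Q? k
  count-mono-< (suc k) {j} P⇒Q j<1+k Qj ¬Pj with P? k | Q? k | m<1+n⇒m<n∨m≡n j<1+k
  ... | yes Pk | no ¬Qk | _ = ⊥-elim (¬Qk (P⇒Q (n<1+n k) Pk))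
  ... | no _ | no ¬Qk | inj₂ refl = ⊥-elim (¬Qk Qj)
  ... | yes Pk | _ | inj₂ refl = ⊥-elim (¬Pj Pk)
  ... | yes _ | yes _ | inj₁ j<k = s≤s (count-mono-< k (below-suc P⇒Q) j<k Qj ¬Pj)
  ... | no _ | no _ | inj₁ j<k = count-mono-< k (below-suc P⇒Q) j<k Qj ¬Pj
  ... | no _ | yes _ | _ = s≤s (count-mono k (below-suc P⇒Q))

  count-≤-1+count : ∀ {r} {R : Pred ℕ r} k → (∀ {i} → i < k → P i → Q i ⊎ R i) →
                    (∀ {i j} → i < k → j < k → R i → R j → i ≡ j) →
                    count P? k ≤ suc (count Q? k)
  count-≤-1+count zero _ _ = z≤n
  count-≤-1+count {R = R} (suc k) P⇒Q∪R R-unique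
    with P? k | Q? k | count-≤-1+count k (below-suc P⇒Q∪R)
                         (λ i<k j<k → R-unique (m<n⇒m<1+n i<k) (m<n⇒m<1+n j<k))
  ... | yes _ | yes _ | ih = s≤s ih
  ... | no _ | yes _ | ih = m≤n⇒m≤1+n ih
  ... | no _ | no _ | ih = ih
  ... | yes Pk | no ¬Qk | _ = s≤s (count-mono k P⇒Q)
    where
    Rk : R k
    Rk with P⇒Q∪R (n<1+n k) Pk
    ... | inj₁ Qk = ⊥-elim (¬Qk Qk)
    ... | inj₂ Rk = Rk
    P⇒Q : ∀ {i} → i < k → P i → Q i
    P⇒Q i<k Pi with P⇒Q∪R (m<n⇒m<1+n i<k) Pi
    ... | inj₁ Qi = Qi
    ... | inj₂ Ri = ⊥-elim (<-irrefl (R-unique (m<n⇒m<1+n i<k) (n<1+n k) Ri Rk) i<k)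

Dominates : ∀ {n} → Graph n → Fin n → Fin n → Set
Dominates G v u = v ≡ u ⊎ G v u

_∈ₚ_ : ∀ {n} → Fin n → Fin n × Fin n → Set
x ∈ₚ (a , b) = x ≡ a ⊎ x ≡ b

_∈ₚ?_ : ∀ {n} (x : Fin n) ab → Dec (x ∈ₚ ab)
x ∈ₚ? (a , b) = (x ≟ a) ⊎-dec (x ≟ b)

Free? : ∀ {n} (D S : Subset n) x → Dec (Free D S x)
Free? D S x = ¬? (x ∈? D) ×-dec ¬? (x ∈? S)

record Pairing (n : ℕ) : Set where
  field
    size     : ℕ
    pair     : ℕ → Fin n × Fin n
    distinct : ∀ {i} → i < size → proj₁ (pair i) ≢ proj₂ (pair i)
    disjoint : ∀ {i j x} → i < size → j < size → x ∈ₚ pair i → x ∈ₚ pair j → i ≡ j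

  Partners : ℕ → Fin n → Fin n → Set
  Partners i x y = x ∈ₚ pair i × y ∈ₚ pair i × x ≢ y

  partner : ∀ {i x} → i < size → x ∈ₚ pair i → ∃ (Partners i x)
  partner i<size x∈@(inj₁ refl) = _ , x∈ , inj₂ refl , distinct i<size
  partner i<size x∈@(inj₂ refl) = _ , x∈ , inj₁ refl , λ x≡ → distinct i<size (sym x≡)

  partner-unique : ∀ {i x y z} → Partners i x y → Partners i x z → y ≡ z
  partner-unique (_ , inj₁ refl , _) (_ , inj₁ refl , _) = refl
  partner-unique (_ , inj₂ refl , _) (_ , inj₂ refl , _) = refl
  partner-unique (inj₁ refl , inj₁ refl , x≢y) (_ , inj₂ refl , _) = ⊥-elim (x≢y refl)
  partner-unique (inj₂ refl , inj₁ refl , _) (_ , inj₂ refl , x≢z) = ⊥-elim (x≢z refl)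
  partner-unique (inj₁ refl , inj₂ refl , _) (_ , inj₁ refl , x≢z) = ⊥-elim (x≢z refl)
  partner-unique (inj₂ refl , inj₂ refl , x≢y) (_ , inj₁ refl , _) = ⊥-elim (x≢y refl)

  partner-unique′ : ∀ {i j x y z} → i < size → j < size → Partners i x y → Partners j x z → y ≡ z
  partner-unique′ i<size j<size xy@(x∈i , _) xz@(x∈j , _)
    with disjoint i<size j<size x∈i x∈j
  ... | refl = partner-unique xy xz

  DominatedByPair : Graph n → Fin n → Set
  DominatedByPair G u =
    ∃ λ i → i < size × Dominates G (proj₁ (pair i)) u × Dominates G (proj₂ (pair i)) u

  NoPairIn : Subset n → Set
  NoPairIn D = ∀ {i} → i < size → ¬ (proj₁ (pair i) ∈ D × proj₂ (pair i) ∈ D)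

module DominatorPairingStrategy {n} (G : Graph n) (P : Pairing n) where
  open Pairing P

  Open : Subset n → Subset n → ℕ → Set
  Open D S i = Free D S (proj₁ (pair i)) × Free D S (proj₂ (pair i))

  Open? : ∀ D S → Decidable (Open D S)
  Open? D S i = Free? D S _ ×-dec Free? D S _

  Claimed : Subset n → ℕ → Set
  Claimed D i = proj₁ (pair i) ∈ D ⊎ proj₂ (pair i) ∈ D

  Covered : Subset n → Set
  Covered D = ∀ u → (∃ λ v → v ∈ D × Dominates G v u) ⊎ DominatedByPair G u

  record Invariant (D S : Subset n) : Set where
    field
      open-or-claimed : ∀ {i} → i < size → Open D S i ⊎ Claimed D i
      covered         : Covered D

  #open : Subset n → Subset n → ℕ
  #open D S = count (Open? D S) size

  dominating : ∀ {D S} → Invariant D S → (∀ {i} → i < size → ¬ Open D S i) → Dominating G D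
  dominating inv none u with Invariant.covered inv u
  ... | inj₁ dominated = dominated
  ... | inj₂ (i , i<size , a⇒u , b⇒u) with Invariant.open-or-claimed inv i<size
  ...   | inj₁ i-open = ⊥-elim (none i<size i-open)
  ...   | inj₂ (inj₁ a∈D) = _ , a∈D , a⇒u
  ...   | inj₂ (inj₂ b∈D) = _ , b∈D , b⇒u

  free-in-open : ∀ {D S i x} → Open D S i → x ∈ₚ pair i → Free D S x
  free-in-open (a-free , _) (inj₁ refl) = a-free
  free-in-open (_ , b-free) (inj₂ refl) = b-free

  module _ {D S x y j} (j<size : j < size) (j-open : Open D S j) (y∈j : y ∈ₚ pair j) (x≢y : x ≢ y) where

    D′ = D ∪ ⁅ y ⁆
    S′ = S ∪ ⁅ x ⁆

    #open-decreases : #open D′ S′ < #open D S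
    #open-decreases = count-mono-< (Open? D′ S′) (Open? D S) size
      (λ _ (a-free , b-free) → shrink a-free , shrink b-free) j<size
      j-open (λ j-open′ → proj₁ (free-in-open j-open′ y∈j) (∈-∪⁅⁆ʳ y))
      where
      shrink : ∀ {z} → Free D′ S′ z → Free D S z
      shrink (z∉D′ , z∉S′) = z∉D′ ∘ ∈-∪⁅⁆ˡ , z∉S′ ∘ ∈-∪⁅⁆ˡ

    y-free : Free D S′ y
    y-free = proj₁ (free-in-open j-open y∈j) , ∉-∪⁅⁆ (proj₂ (free-in-open j-open y∈j)) (x≢y ∘ sym)

    invariant-after-claim : (∀ {l} → l < size → Open D S l → x ∈ₚ pair l → l ≡ j) →
                Invariant D S → Invariant D′ S′
    invariant-after-claim x-only-in-j inv = record
      { open-or-claimed = open-or-claimed′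
      ; covered         = covered′
      }
      where
      open Invariant inv

      covered′ : Covered D′
      covered′ u with covered u
      ... | inj₁ (v , v∈D , v⇒u) = inj₁ (v , ∈-∪⁅⁆ˡ v∈D , v⇒u)
      ... | inj₂ by-pair = inj₂ by-pair

      stays-free : ∀ {z} → Free D S z → z ≢ y → z ≢ x → Free D′ S′ z
      stays-free (z∉D , z∉S) z≢y z≢x = ∉-∪⁅⁆ z∉D z≢y , ∉-∪⁅⁆ z∉S z≢x

      claimed-by-y : ∀ {l} → y ∈ₚ pair l → Claimed D′ l
      claimed-by-y (inj₁ refl) = inj₁ (∈-∪⁅⁆ʳ y)
      claimed-by-y (inj₂ refl) = inj₂ (∈-∪⁅⁆ʳ y)

      open-or-claimed′ : ∀ {l} → l < size → Open D′ S′ l ⊎ Claimed D′ l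
      open-or-claimed′ {l} l<size with open-or-claimed l<size
      ... | inj₂ (inj₁ a∈D) = inj₂ (inj₁ (∈-∪⁅⁆ˡ a∈D))
      ... | inj₂ (inj₂ b∈D) = inj₂ (inj₂ (∈-∪⁅⁆ˡ b∈D))
      ... | inj₁ l-open@(a-free , b-free) with y ∈ₚ? pair l | x ∈ₚ? pair l
      ...   | yes y∈l | _ = inj₂ (claimed-by-y y∈l)
      ...   | no y∉l | yes x∈l with x-only-in-j l<size l-open x∈l
      ...     | refl = ⊥-elim (y∉l y∈j)
      open-or-claimed′ l<size | inj₁ (a-free , b-free) | no y∉l | no x∉l =
        inj₁ ( stays-free a-free (y∉l ∘ inj₁ ∘ sym) (x∉l ∘ inj₁ ∘ sym)
             , stays-free b-free (y∉l ∘ inj₂ ∘ sym) (x∉l ∘ inj₂ ∘ sym))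

  mutual
    wins : ∀ k {D S} → Invariant D S → #open D S ≤ k → STurn G k D S
    wins k {D} {S} inv #≤k with anyUpTo? (Open? D S) size
    ... | no none = s-done (dominating inv (λ i<size i-open → none (_ , i<size , i-open)))
    ... | yes (i₀ , i₀<size , i₀-open) =
      s-move (_ , proj₁ i₀-open) (respond k inv #≤k i₀<size i₀-open)

    respond : ∀ k {D S i₀} → Invariant D S → #open D S ≤ k → i₀ < size → Open D S i₀ →
              ∀ x → Free D S x → DTurn G k D (S ∪ ⁅ x ⁆)
    respond zero {D} {S} _ #≤0 i₀<size i₀-open _ _ =
      ⊥-elim (<-irrefl refl (≤-trans (count-pos (Open? D S) size i₀<size i₀-open) #≤0))
    respond (suc k) {D} {S} inv #≤k i₀<size i₀-open x _
      with anyUpTo? (λ j → Open? D S j ×-dec x ∈ₚ? pair j) size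
    ... | yes (j , j<size , j-open , x∈j) with partner j<size x∈j
    ...   | _ , _ , y∈j , x≢y =
      claim k inv #≤k j<size j-open y∈j x≢y (λ l<size _ x∈l → disjoint l<size j<size x∈l x∈j)
    respond (suc k) inv #≤k i₀<size i₀-open x _ | no x-in-no-open-pair =
      claim k inv #≤k i₀<size i₀-open (inj₁ refl)
        (λ x≡ → x-in-no-open-pair (_ , i₀<size , i₀-open , inj₁ x≡))
        (λ l<size l-open x∈l → ⊥-elim (x-in-no-open-pair (_ , l<size , l-open , x∈l)))

    claim : ∀ k {D S x y j} → Invariant D S → #open D S ≤ suc k →
            j < size → Open D S j → y ∈ₚ pair j → x ≢ y →
            (∀ {l} → l < size → Open D S l → x ∈ₚ pair l → l ≡ j) →
            DTurn G (suc k) D (S ∪ ⁅ x ⁆)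
    claim k inv #≤k j<size j-open y∈j x≢y x-only-in-j =
      d-move _ (y-free j<size j-open y∈j x≢y)
        (wins k (invariant-after-claim j<size j-open y∈j x≢y x-only-in-j inv)
                (≤-pred (≤-trans (#open-decreases j<size j-open y∈j x≢y) #≤k)))

module StallerPairingStrategy {n} (G : Graph n) (P : Pairing n)
  (m : ℕ) (block : ℕ → List (Fin n))
  (blocks-disjoint : ∀ {i j x} → i < m → j < m → x ∈ˡ block i → x ∈ˡ block j → i ≡ j)
  (blocks-hit : ∀ {D} → Dominating G D → Pairing.NoPairIn P D → ∀ {i} → i < m → Any (_∈ D) (block i))
  where
  open Pairing P

  Apart : Subset n → Subset n → Set
  Apart D S = ∀ {x} → x ∈ D → x ∉ S

  record Answered (D S : Subset n) : Set where
    field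
      apart   : Apart D S
      answers : ∀ {i x y} → i < size → Partners i x y → x ∈ D → y ∈ S

  record Unanswered (v : Fin n) (D S : Subset n) : Set where
    field
      apart   : Apart D S
      v∈D     : v ∈ D
      answers : ∀ {i x y} → i < size → Partners i x y → x ∈ D → y ∈ S ⊎ x ≡ v

  no-pair-in : ∀ {D S} → Answered D S → NoPairIn D
  no-pair-in inv i<size (a∈D , b∈D) =
    Answered.apart inv b∈D (Answered.answers inv i<size (inj₁ refl , inj₂ refl , distinct i<size) a∈D)

  no-pair-inᵘ : ∀ {v D S} → Unanswered v D S → NoPairIn D
  no-pair-inᵘ inv i<size (a∈D , b∈D)
    with Unanswered.answers inv i<size (inj₁ refl , inj₂ refl , distinct i<size) a∈D
       | Unanswered.answers inv i<size (inj₂ refl , inj₁ refl , distinct i<size ∘ sym) b∈D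
  ... | inj₁ b∈S | _ = Unanswered.apart inv b∈D b∈S
  ... | _ | inj₁ a∈S = Unanswered.apart inv a∈D a∈S
  ... | inj₂ refl | inj₂ b≡a = distinct i<size (sym b≡a)

  apart-∪ : ∀ {D S y} → Apart D S → y ∉ D → Apart D (S ∪ ⁅ y ⁆)
  apart-∪ apart y∉D x∈D x∈S∪y with ∈-∪⁅⁆⁻ x∈S∪y
  ... | inj₁ x∈S = apart x∈D x∈S
  ... | inj₂ refl = y∉D x∈D

  staller-moves : ∀ {D S w} → Free D S w → Answered D S → Answered D (S ∪ ⁅ w ⁆)
  staller-moves (w∉D , _) inv = record
    { apart   = apart-∪ (Answered.apart inv) w∉D
    ; answers = λ i<size xy x∈D → ∈-∪⁅⁆ˡ (Answered.answers inv i<size xy x∈D)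
    }

  dominator-moves : ∀ {D S v} → Free D S v → Answered D S → Unanswered v (D ∪ ⁅ v ⁆) S
  dominator-moves {D} {S} {v} (_ , v∉S) inv = record
    { apart   = apart′
    ; v∈D     = ∈-∪⁅⁆ʳ v
    ; answers = answers′
    }
    where
    open Answered inv
    apart′ : Apart (D ∪ ⁅ v ⁆) S
    apart′ x∈D∪v x∈S with ∈-∪⁅⁆⁻ x∈D∪v
    ... | inj₁ x∈D = apart x∈D x∈S
    ... | inj₂ refl = v∉S x∈S
    answers′ : ∀ {i x y} → i < size → Partners i x y → x ∈ D ∪ ⁅ v ⁆ → y ∈ S ⊎ x ≡ v
    answers′ i<size xy x∈D∪v with ∈-∪⁅⁆⁻ x∈D∪v
    ... | inj₁ x∈D = inj₁ (answers i<size xy x∈D)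
    ... | inj₂ x≡v = inj₂ x≡v

  answered : ∀ {v D S} → Unanswered v D S →
             (∀ {i y} → i < size → Partners i v y → y ∈ S) → Answered D S
  answered {D = D} {S} inv v-answered = record
    { apart   = Unanswered.apart inv
    ; answers = answers′
    }
    where
    answers′ : ∀ {i x y} → i < size → Partners i x y → x ∈ D → y ∈ S
    answers′ i<size xy x∈D with Unanswered.answers inv i<size xy x∈D
    ... | inj₁ y∈S = y∈S
    ... | inj₂ refl = v-answered i<size xy

  staller-answers : ∀ {v D S} → Unanswered v D S → ∃ (Free D S) →
                    ∃ λ w → Free D S w × Answered D (S ∪ ⁅ w ⁆)
  staller-answers {v} {D} {S} inv (w₀ , w₀-free) with anyUpTo? (λ i → v ∈ₚ? pair i) size
  ... | no v-unpaired =
    w₀ , w₀-free , staller-moves w₀-free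
      (answered inv (λ i<size (v∈i , _) → ⊥-elim (v-unpaired (_ , i<size , v∈i))))
  ... | yes (i , i<size , v∈i) with partner i<size v∈i
  ...   | y , vy with y ∈? S
  ...     | yes y∈S =
    w₀ , w₀-free , staller-moves w₀-free
      (answered inv (λ j<size vy′ → subst (_∈ S) (partner-unique′ i<size j<size vy vy′) y∈S))
  ...     | no y∉S = y , (y∉D , y∉S) , answered inv′
      (λ j<size vy′ → subst (_∈ S ∪ ⁅ y ⁆) (partner-unique′ i<size j<size vy vy′) (∈-∪⁅⁆ʳ y))
    where
    open Unanswered inv
    y∉D : y ∉ D
    y∉D y∈D with answers i<size (proj₁ (proj₂ vy) , proj₁ vy , proj₂ (proj₂ vy) ∘ sym) y∈D
    ... | inj₁ v∈S = apart v∈D v∈S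
    ... | inj₂ y≡v = proj₂ (proj₂ vy) (sym y≡v)
    inv′ : Unanswered v D (S ∪ ⁅ y ⁆)
    inv′ = record
      { apart   = apart-∪ apart y∉D
      ; v∈D     = v∈D
      ; answers = λ j<size xy′ x∈D → map₁ ∈-∪⁅⁆ˡ (answers j<size xy′ x∈D)
      }

  Unhit : Subset n → ℕ → Set
  Unhit D i = ¬ Any (_∈ D) (block i)

  Unhit? : ∀ D → Decidable (Unhit D)
  Unhit? D i = ¬? (any? (_∈? D) (block i))

  #unhit : Subset n → ℕ
  #unhit D = count (Unhit? D) m

  #unhit-⊥ : #unhit ⊥ ≡ m
  #unhit-⊥ = count-all (Unhit? ⊥) m (λ _ hit → ∉⊥ (proj₂ (Any.satisfied hit)))

  #unhit-dominating : ∀ {D} → Dominating G D → NoPairIn D → #unhit D ≡ 0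
  #unhit-dominating {D} dom no-pair =
    count-none (Unhit? D) m (λ i<m unhit → unhit (blocks-hit dom no-pair i<m))

  #unhit-step : ∀ D v → #unhit D ≤ suc (#unhit (D ∪ ⁅ v ⁆))
  #unhit-step D v = count-≤-1+count (Unhit? D) (Unhit? (D ∪ ⁅ v ⁆)) m
    (λ {i} _ unhit → newly-hit i unhit)
    blocks-disjoint
    where
    newly-hit : ∀ i → Unhit D i → Unhit (D ∪ ⁅ v ⁆) i ⊎ v ∈ˡ block i
    newly-hit i unhit with any? (_∈? D ∪ ⁅ v ⁆) (block i)
    ... | no unhit′ = inj₁ unhit′
    ... | yes hit with Any-⊎⁻ (Any.map ∈-∪⁅⁆⁻ hit)
    ...   | inj₁ hit-by-D = ⊥-elim (unhit hit-by-D)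
    ...   | inj₂ hit-by-v = inj₂ (Any.map sym hit-by-v)

  mutual
    lower-bound : ∀ {k D S} → DTurn G k D S → Answered D S → #unhit D ≤ k
    lower-bound (d-done dom) inv = ≤-trans (≤-reflexive (#unhit-dominating dom (no-pair-in inv))) z≤n
    lower-bound {suc k} {D} (d-move v v-free next) inv =
      ≤-trans (#unhit-step D v) (s≤s (lower-boundᵘ next (dominator-moves v-free inv)))

    lower-boundᵘ : ∀ {k v D S} → STurn G k D S → Unanswered v D S → #unhit D ≤ k
    lower-boundᵘ (s-done dom) inv = ≤-trans (≤-reflexive (#unhit-dominating dom (no-pair-inᵘ inv))) z≤n
    lower-boundᵘ (s-move free-vertex next) inv with staller-answers inv free-vertex
    ... | w , w-free , inv′ = lower-bound (next w w-free) inv′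

  lower-boundˢ : ∀ {k D S} → STurn G k D S → Answered D S → #unhit D ≤ k
  lower-boundˢ (s-done dom) inv = ≤-trans (≤-reflexive (#unhit-dominating dom (no-pair-in inv))) z≤n
  lower-boundˢ (s-move (w , w-free) next) inv = lower-bound (next w w-free) (staller-moves w-free inv)

  answered-⊥ : Answered ⊥ ⊥
  answered-⊥ = record { apart = λ x∈⊥ _ → ∉⊥ x∈⊥ ; answers = λ _ _ x∈⊥ → ⊥-elim (∉⊥ x∈⊥) }

  γ-lower : ∀ {k} → DTurn G k ⊥ ⊥ → m ≤ k
  γ-lower game = subst (_≤ _) #unhit-⊥ (lower-bound game answered-⊥)

  γ′-lower : ∀ {k} → STurn G k ⊥ ⊥ → m ≤ k
  γ′-lower game = subst (_≤ _) #unhit-⊥ (lower-boundˢ game answered-⊥)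

i+i≡i*2 : ∀ i → i + i ≡ i * 2
i+i≡i*2 i = trans (cong (i +_) (sym (+-identityʳ i))) (*-comm 2 i)

[m+[i+i]]%2≡m%2 : ∀ m i → (m + (i + i)) % 2 ≡ m % 2
[m+[i+i]]%2≡m%2 m i = trans (cong (λ k → (m + k) % 2) (i+i≡i*2 i)) ([m+kn]%n≡m%n m i 2)

i+i≢1+j+j : ∀ i j → i + i ≢ suc (j + j)
i+i≢1+j+j i j i+i≡1+j+j with trans (sym ([m+[i+i]]%2≡m%2 0 i))
                                    (trans (cong (_% 2) i+i≡1+j+j) ([m+[i+i]]%2≡m%2 1 j))
... | ()

i+i-injective : ∀ {i j} → i + i ≡ j + j → i ≡ j
i+i-injective {i} {j} eq = *-cancelʳ-≡ i j 2 (trans (sym (i+i≡i*2 i)) (trans eq (i+i≡i*2 j)))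

2+i+i≤p+p : ∀ {i p} → i < p → suc (suc (i + i)) ≤ p + p
2+i+i≤p+p {i} {p} i<p = subst (_≤ p + p) (cong suc (+-suc i i)) (+-mono-≤ i<p i<p)

parity : ∀ t → t ≡ t / 2 + t / 2 ⊎ t ≡ suc (t / 2 + t / 2)
parity t with t % 2 | m%n<n t 2 | m≡m%n+[m/n]*n t 2
... | 0 | _ | t≡ = inj₁ (trans t≡ (sym (i+i≡i*2 (t / 2))))
... | 1 | _ | t≡ = inj₂ (trans t≡ (cong suc (sym (i+i≡i*2 (t / 2)))))
... | suc (suc _) | s≤s (s≤s ()) | _

halve : ∀ {t p} → t < p + p → ∃ λ i → i < p × (t ≡ i + i ⊎ t ≡ suc (i + i))
halve {t} {p} t<p+p = t / 2 , m<n*o⇒m/o<n (subst (t <_) (i+i≡i*2 p) t<p+p) , parity t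

module CycleArithmetic (n : ℕ) .{{_ : NonZero n}} where

  vtx : ℕ → Fin n
  vtx k = k mod n

  toℕ-vtx : ∀ k → toℕ (vtx k) ≡ k % n
  toℕ-vtx k = toℕ-fromℕ< (m%n<n k n)

  toℕ-vtx-< : ∀ {k} → k < n → toℕ (vtx k) ≡ k
  toℕ-vtx-< {k} k<n = trans (toℕ-vtx k) (m<n⇒m%n≡m k<n)

  vtx-toℕ : ∀ u → vtx (toℕ u) ≡ u
  vtx-toℕ u = toℕ-injective (toℕ-vtx-< (toℕ<n u))

  vtx-n+ : ∀ k → vtx (n + k) ≡ vtx k
  vtx-n+ k = toℕ-injective (begin
    toℕ (vtx (n + k)) ≡⟨ toℕ-vtx (n + k) ⟩
    (n + k) % n       ≡⟨ cong (_% n) (+-comm n k) ⟩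
    (k + n) % n       ≡⟨ [m+n]%n≡m%n k n ⟩
    k % n             ≡⟨ toℕ-vtx k ⟨
    toℕ (vtx k)       ∎)
    where open ≡-Reasoning

  [1+k]%n≡[1+k%n]%n : ∀ k → suc k % n ≡ suc (k % n) % n
  [1+k]%n≡[1+k%n]%n k = trans (cong (λ j → suc j % n) (m≡m%n+[m/n]*n k n))
                              ([m+kn]%n≡m%n (suc (k % n)) (k / n) n)

  suc-% : ∀ k → suc k % n ≡ suc (k % n) ⊎ (suc k % n ≡ 0 × k % n ≡ n ∸ 1)
  suc-% k with m≤n⇒m<n∨m≡n (m%n<n k n)
  ... | inj₁ 1+k%n<n = inj₁ (trans ([1+k]%n≡[1+k%n]%n k) (m<n⇒m%n≡m 1+k%n<n))
  ... | inj₂ 1+k%n≡n =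
    inj₂ (trans ([1+k]%n≡[1+k%n]%n k) (trans (cong (_% n) 1+k%n≡n) (n%n≡0 n)) , cong pred 1+k%n≡n)

  toℕ-vtx-suc : ∀ k → toℕ (vtx (suc k)) ≡ suc (toℕ (vtx k))
                    ⊎ (toℕ (vtx (suc k)) ≡ 0 × toℕ (vtx k) ≡ n ∸ 1)
  toℕ-vtx-suc k rewrite toℕ-vtx (suc k) | toℕ-vtx k = suc-% k

  1+[n∸1]≡n : suc (n ∸ 1) ≡ n
  1+[n∸1]≡n = m+[n∸m]≡n (>-nonZero⁻¹ n)

  cycle-sym : ∀ {u v} → Cycle n u v → Cycle n v u
  cycle-sym (inj₁ v≡1+u) = inj₂ (inj₁ v≡1+u)
  cycle-sym (inj₂ (inj₁ u≡1+v)) = inj₁ u≡1+v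
  cycle-sym (inj₂ (inj₂ (inj₁ wrap))) = inj₂ (inj₂ (inj₂ wrap))
  cycle-sym (inj₂ (inj₂ (inj₂ wrap))) = inj₂ (inj₂ (inj₁ wrap))

  adjacent-suc : ∀ k → Cycle n (vtx k) (vtx (suc k))
  adjacent-suc k with toℕ-vtx-suc k
  ... | inj₁ step = inj₁ step
  ... | inj₂ wrap = inj₂ (inj₂ (inj₂ wrap))

  neighbours-of-vtx : ∀ {k v} → Cycle n v (vtx (suc k)) → v ≡ vtx k ⊎ v ≡ vtx (suc (suc k))
  neighbours-of-vtx {k} (inj₁ 1+k≡1+v) with toℕ-vtx-suc k
  ... | inj₁ 1+k≡1+[k] = inj₁ (toℕ-injective (suc-injective (trans (sym 1+k≡1+v) 1+k≡1+[k])))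
  ... | inj₂ (1+k≡0 , _) with trans (sym 1+k≡1+v) 1+k≡0
  ...   | ()
  neighbours-of-vtx {k} {v} (inj₂ (inj₁ v≡1+[1+k])) with toℕ-vtx-suc (suc k)
  ... | inj₁ 2+k≡1+[1+k] = inj₂ (toℕ-injective (trans v≡1+[1+k] (sym 2+k≡1+[1+k])))
  ... | inj₂ (_ , 1+k≡n-1) =
    ⊥-elim (<-irrefl (trans v≡1+[1+k] (trans (cong suc 1+k≡n-1) 1+[n∸1]≡n)) (toℕ<n v))
  neighbours-of-vtx {k} (inj₂ (inj₂ (inj₁ (v≡0 , 1+k≡n-1)))) with toℕ-vtx-suc (suc k)
  ... | inj₁ 2+k≡1+[1+k] =
    ⊥-elim (<-irrefl (trans 2+k≡1+[1+k] (trans (cong suc 1+k≡n-1) 1+[n∸1]≡n))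
                     (toℕ<n (vtx (suc (suc k)))))
  ... | inj₂ (2+k≡0 , _) = inj₂ (toℕ-injective (trans v≡0 (sym 2+k≡0)))
  neighbours-of-vtx {k} (inj₂ (inj₂ (inj₂ (1+k≡0 , v≡n-1)))) with toℕ-vtx-suc k
  ... | inj₁ 1+k≡1+[k] with trans (sym 1+k≡0) 1+k≡1+[k]
  ...   | ()
  neighbours-of-vtx {k} (inj₂ (inj₂ (inj₂ (1+k≡0 , v≡n-1)))) | inj₂ (_ , k≡n-1) =
    inj₁ (toℕ-injective (trans v≡n-1 (sym k≡n-1)))

  dominators-of-vtx : ∀ {k v} → Dominates (Cycle n) v (vtx (suc k)) →
                      v ≡ vtx k ⊎ v ≡ vtx (suc k) ⊎ v ≡ vtx (suc (suc k))
  dominators-of-vtx (inj₁ v≡1+k) = inj₂ (inj₁ v≡1+k)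
  dominators-of-vtx (inj₂ v~1+k) with neighbours-of-vtx v~1+k
  ... | inj₁ v≡k = inj₁ v≡k
  ... | inj₂ v≡2+k = inj₂ (inj₂ v≡2+k)

  [x+d]%n≡x%n⇒d≡0 : ∀ x {d} → d < n → (x + d) % n ≡ x % n → d ≡ 0
  [x+d]%n≡x%n⇒d≡0 x {d} d<n eq = shift-fixes (m%n<n x n) (begin
    (x % n + d) % n       ≡⟨ cong (λ j → (x % n + j) % n) (m<n⇒m%n≡m d<n) ⟨
    (x % n + d % n) % n   ≡⟨ %-distribˡ-+ x d n ⟨
    (x + d) % n           ≡⟨ eq ⟩
    x % n                 ∎)
    where
    open ≡-Reasoning
    shift-fixes : ∀ {t} → t < n → (t + d) % n ≡ t → d ≡ 0
    shift-fixes {t} t<n fixed with t + d <? n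
    ... | yes t+d<n =
      +-cancelˡ-≡ t d 0 (trans (trans (sym (m<n⇒m%n≡m t+d<n)) fixed) (sym (+-identityʳ t)))
    ... | no t+d≮n = ⊥-elim (<-irrefl d≡n d<n)
      where
      n≤t+d = ≮⇒≥ t+d≮n
      t+d∸n<n : t + d ∸ n < n
      t+d∸n<n = +-cancelʳ-< _ _ n (subst (_< n + n) (sym (m∸n+n≡m n≤t+d)) (+-mono-< t<n d<n))
      t+d∸n≡t : t + d ∸ n ≡ t
      t+d∸n≡t = begin
        t + d ∸ n       ≡⟨ m<n⇒m%n≡m t+d∸n<n ⟨
        (t + d ∸ n) % n ≡⟨ m≤n⇒[n∸m]%m≡n%m n≤t+d ⟩
        (t + d) % n     ≡⟨ fixed ⟩
        t               ∎
      d≡n : d ≡ n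
      d≡n = +-cancelˡ-≡ t d n (trans (sym (m∸n+n≡m n≤t+d)) (cong (_+ n) t+d∸n≡t))

  vtx-injective-≤ : ∀ c {a b} → a ≤ b → b < n → vtx (c + a) ≡ vtx (c + b) → a ≡ b
  vtx-injective-≤ c {a} {b} a≤b b<n eq = begin
    a             ≡⟨ +-identityʳ a ⟨
    a + 0         ≡⟨ cong (a +_) b∸a≡0 ⟨
    a + (b ∸ a)   ≡⟨ m+[n∸m]≡n a≤b ⟩
    b             ∎
    where
    open ≡-Reasoning
    b∸a≡0 : b ∸ a ≡ 0
    b∸a≡0 = [x+d]%n≡x%n⇒d≡0 (c + a) (≤-<-trans (m∸n≤m b a) b<n) (begin
      (c + a + (b ∸ a)) % n   ≡⟨ cong (_% n) (+-assoc c a (b ∸ a)) ⟩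
      (c + (a + (b ∸ a))) % n ≡⟨ cong (λ j → (c + j) % n) (m+[n∸m]≡n a≤b) ⟩
      (c + b) % n             ≡⟨ toℕ-vtx (c + b) ⟨
      toℕ (vtx (c + b))       ≡⟨ cong toℕ eq ⟨
      toℕ (vtx (c + a))       ≡⟨ toℕ-vtx (c + a) ⟩
      (c + a) % n             ∎)

  vtx-injective : ∀ c {a b} → a < n → b < n → vtx (c + a) ≡ vtx (c + b) → a ≡ b
  vtx-injective c a<n b<n eq with ≤-total _ _
  ... | inj₁ a≤b = vtx-injective-≤ c a≤b b<n eq
  ... | inj₂ b≤a = sym (vtx-injective-≤ c b≤a a<n (sym eq))

  vtx-suc-+ : ∀ c t → vtx (suc c + t) ≡ vtx (c + suc t)
  vtx-suc-+ c t = cong vtx (sym (+-suc c t))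

  vtx-+n : ∀ c → vtx (c + n) ≡ vtx c
  vtx-+n c = trans (cong vtx (+-comm c n)) (vtx-n+ c)

  vtx-+-≢ : ∀ c {d} → 0 < d → d < n → vtx (c + d) ≢ vtx c
  vtx-+-≢ c 0<d d<n eq
    with vtx-injective c d<n (>-nonZero⁻¹ n) (trans eq (cong vtx (sym (+-identityʳ c))))
  ... | refl = <-irrefl refl 0<d

  vtx-offset : ∀ c → c ≤ n → ∀ u → ∃ λ d → d < n × u ≡ vtx (c + d)
  vtx-offset c c≤n u with c ≤? toℕ u
  ... | yes c≤u = toℕ u ∸ c , ≤-<-trans (m∸n≤m (toℕ u) c) (toℕ<n u) ,
                  trans (sym (vtx-toℕ u)) (cong vtx (sym (m+[n∸m]≡n c≤u)))
  ... | no c≰u = n ∸ c + toℕ u ,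
                 subst (n ∸ c + toℕ u <_) (m∸n+n≡m c≤n) (+-monoʳ-< (n ∸ c) (≰⇒> c≰u)) ,
                 (begin
                   u                       ≡⟨ vtx-toℕ u ⟨
                   vtx (toℕ u)             ≡⟨ vtx-n+ (toℕ u) ⟨
                   vtx (n + toℕ u)         ≡⟨ cong (λ j → vtx (j + toℕ u)) (m+[n∸m]≡n c≤n) ⟨
                   vtx (c + (n ∸ c) + toℕ u) ≡⟨ cong vtx (+-assoc c (n ∸ c) (toℕ u)) ⟩
                   vtx (c + (n ∸ c + toℕ u)) ∎)
    where open ≡-Reasoning

  vtx-≡⇒%2≡ : ∀ {h a b} → n ≡ h + h → vtx a ≡ vtx b → a % 2 ≡ b % 2
  vtx-≡⇒%2≡ {h} {a} {b} n≡h+h eq = begin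
    a % 2               ≡⟨ m∣n⇒o%n%m≡o%m 2 n a 2∣n ⟨
    a % n % 2           ≡⟨ cong (_% 2) (toℕ-vtx a) ⟨
    toℕ (vtx a) % 2     ≡⟨ cong (λ u → toℕ u % 2) eq ⟩
    toℕ (vtx b) % 2     ≡⟨ cong (_% 2) (toℕ-vtx b) ⟩
    b % n % 2           ≡⟨ m∣n⇒o%n%m≡o%m 2 n b 2∣n ⟩
    b % 2               ∎
    where
    open ≡-Reasoning
    2∣n = divides h (trans n≡h+h (i+i≡i*2 h))

  adjacent-+suc : ∀ c k → Cycle n (vtx (c + k)) (vtx (c + suc k))
  adjacent-+suc c k = subst (λ j → Cycle n (vtx (c + k)) (vtx j)) (sym (+-suc c k)) (adjacent-suc (c + k))

  middle-hit : ∀ {D} c → Dominating (Cycle n) D → ¬ (vtx c ∈ D × vtx (3 + c) ∈ D) →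
               Any (_∈ D) (vtx (1 + c) ∷ vtx (2 + c) ∷ [])
  middle-hit {D} c dom not-both with dom (vtx (1 + c)) | dom (vtx (2 + c))
  ... | v , v∈D , v⇒1+c | w , w∈D , w⇒2+c with dominators-of-vtx v⇒1+c | dominators-of-vtx w⇒2+c
  ...   | inj₂ (inj₁ refl) | _ = here v∈D
  ...   | inj₂ (inj₂ refl) | _ = there (here v∈D)
  ...   | inj₁ _ | inj₁ refl = here w∈D
  ...   | inj₁ _ | inj₂ (inj₁ refl) = there (here w∈D)
  ...   | inj₁ refl | inj₂ (inj₂ refl) = ⊥-elim (not-both (v∈D , w∈D))

  neighbourhood-hit : ∀ {D} k → Dominating (Cycle n) D → Any (_∈ D) (vtx k ∷ vtx (1 + k) ∷ vtx (2 + k) ∷ [])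
  neighbourhood-hit k dom with dom (vtx (1 + k))
  ... | v , v∈D , v⇒1+k with dominators-of-vtx v⇒1+k
  ...   | inj₁ refl = here v∈D
  ...   | inj₂ (inj₁ refl) = there (here v∈D)
  ...   | inj₂ (inj₂ refl) = there (there (here v∈D))

module ConsecutivePairs (n : ℕ) .{{_ : NonZero n}} (c p : ℕ) (p+p≤n : p + p ≤ n) where
  open CycleArithmetic n

  first second : ℕ → Fin n
  first i = vtx (c + (i + i))
  second i = vtx (c + suc (i + i))

  private
    1+i+i<n : ∀ {i} → i < p → suc (i + i) < n
    1+i+i<n i<p = ≤-trans (2+i+i≤p+p i<p) p+p≤n

    i+i<n : ∀ {i} → i < p → i + i < n
    i+i<n i<p = <-trans (n<1+n _) (1+i+i<n i<p)

  pairing : Pairing n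
  pairing = record
    { size     = p
    ; pair     = λ i → first i , second i
    ; distinct = λ i<p eq → 1+n≢n (sym (vtx-injective c (i+i<n i<p) (1+i+i<n i<p) eq))
    ; disjoint = disjoint
    }
    where
    disjoint : ∀ {i j x} → i < p → j < p → x ∈ₚ (first i , second i) → x ∈ₚ (first j , second j) → i ≡ j
    disjoint i<p j<p (inj₁ refl) (inj₁ x≡) = i+i-injective (vtx-injective c (i+i<n i<p) (i+i<n j<p) x≡)
    disjoint i<p j<p (inj₂ refl) (inj₂ x≡) =
      i+i-injective (suc-injective (vtx-injective c (1+i+i<n i<p) (1+i+i<n j<p) x≡))
    disjoint {i} {j} i<p j<p (inj₁ refl) (inj₂ x≡) =
      ⊥-elim (i+i≢1+j+j i j (vtx-injective c (i+i<n i<p) (1+i+i<n j<p) x≡))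
    disjoint {i} {j} i<p j<p (inj₂ refl) (inj₁ x≡) =
      ⊥-elim (i+i≢1+j+j j i (vtx-injective c (i+i<n j<p) (1+i+i<n i<p) (sym x≡)))

  cover : ∀ {t} → t < p + p → Pairing.DominatedByPair pairing (Cycle n) (vtx (c + t))
  cover t<p+p with halve {p = p} t<p+p
  ... | i , i<p , inj₁ refl = i , i<p , inj₁ refl , inj₂ (cycle-sym (adjacent-+suc c (i + i)))
  ... | i , i<p , inj₂ refl = i , i<p , inj₂ (adjacent-+suc c (i + i)) , inj₁ refl

module CycleUpperBounds (n : ℕ) .{{_ : NonZero n}} where
  open CycleArithmetic n

  γ′-upper-even : ∀ p → n ≡ p + p → STurn (Cycle n) p ⊥ ⊥
  γ′-upper-even p n≡p+p = wins p invariant (count-≤ _ p)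
    where
    open ConsecutivePairs n 0 p (≤-reflexive (sym n≡p+p))
    open DominatorPairingStrategy (Cycle n) pairing
    open Pairing pairing using (DominatedByPair)
    invariant : Invariant ⊥ ⊥
    invariant = record
      { open-or-claimed = λ _ → inj₁ ((∉⊥ , ∉⊥) , (∉⊥ , ∉⊥))
      ; covered         = λ u → inj₂ (subst (DominatedByPair (Cycle n)) (vtx-toℕ u)
                                            (cover (subst (toℕ u <_) n≡p+p (toℕ<n u))))
      }

  holding-vtx-wins : ∀ m c → c ≤ n → 2 + (m + m) ≤ n → n ≤ 3 + (m + m) → ∀ {S} →
                    (∀ {t} → t < m + m → vtx (2 + c + t) ∉ S) → STurn (Cycle n) m (⊥ ∪ ⁅ vtx c ⁆) S
  holding-vtx-wins m c c≤n 2+2m≤n n≤3+2m {S} avoids = wins m invariant (count-≤ _ m)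
    where
    open ConsecutivePairs n (2 + c) m (≤-trans (m≤n+m (m + m) 2) 2+2m≤n)
    open DominatorPairingStrategy (Cycle n) pairing
    open Pairing pairing using (DominatedByPair)
    D = ⊥ ∪ ⁅ vtx c ⁆

    vtx-2+c+ : ∀ t → vtx (2 + c + t) ≡ vtx (c + (2 + t))
    vtx-2+c+ t = trans (vtx-suc-+ (suc c) t) (vtx-suc-+ c (suc t))

    free : ∀ {t} → t < m + m → Free D S (vtx (2 + c + t))
    free {t} t<2m =
        ∉-∪⁅⁆ ∉⊥ (vtx-+-≢ c (s≤s z≤n) (≤-trans (s≤s (s≤s t<2m)) 2+2m≤n) ∘ trans (sym (vtx-2+c+ t)))
      , avoids t<2m

    by-c : ∀ {u} → Dominates (Cycle n) (vtx c) u →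
           (∃ λ v → v ∈ D × Dominates (Cycle n) v u) ⊎ DominatedByPair (Cycle n) u
    by-c c⇒u = inj₁ (vtx c , ∈-∪⁅⁆ʳ (vtx c) , c⇒u)

    vtx-c+0 : vtx (c + 0) ≡ vtx c
    vtx-c+0 = cong vtx (+-identityʳ c)

    covered : Covered D
    covered u with vtx-offset c c≤n u
    ... | zero , _ , refl = by-c (inj₁ (sym vtx-c+0))
    ... | suc zero , _ , refl =
      by-c (inj₂ (subst (λ v → Cycle n v (vtx (c + 1))) vtx-c+0 (adjacent-+suc c 0)))
    ... | suc (suc t) , d<n , refl with t <? m + m
    ...   | yes t<2m = inj₂ (subst (DominatedByPair (Cycle n)) (vtx-2+c+ t) (cover t<2m))
    ...   | no t≮2m =
      by-c (inj₂ (subst (λ v → Cycle n v (vtx (c + d))) c+1+d≡c (cycle-sym (adjacent-+suc c d))))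
      where
      d = suc (suc t)
      c+1+d≡c : vtx (c + suc d) ≡ vtx c
      c+1+d≡c = trans (cong (λ k → vtx (c + k)) 1+d≡n) (vtx-+n c)
        where
        1+d≡n : suc d ≡ n
        1+d≡n = ≤-antisym d<n (≤-trans n≤3+2m (s≤s (s≤s (s≤s (≮⇒≥ t≮2m)))))

    invariant : Invariant D S
    invariant = record
      { open-or-claimed = λ i<m →
          inj₁ (free (<-trans (n<1+n _) (2+i+i≤p+p i<m)) , free (2+i+i≤p+p i<m))
      ; covered         = covered
      }

  γ-upper : ∀ m → 2 + (m + m) ≤ n → n ≤ 3 + (m + m) → DTurn (Cycle n) (suc m) ⊥ ⊥
  γ-upper m 2+2m≤n n≤3+2m =
    d-move (vtx 0) (∉⊥ , ∉⊥) (holding-vtx-wins m 0 z≤n 2+2m≤n n≤3+2m (λ _ → ∉⊥))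

  -- Staller's first vertex x is the predecessor of Dominator's answer, the one
  -- vertex holding-vtx-wins leaves unpaired when n is odd.
  γ′-upper-odd : ∀ m → n ≡ 3 + (m + m) → STurn (Cycle n) (suc m) ⊥ ⊥
  γ′-upper-odd m n≡3+2m = s-move (vtx 0 , ∉⊥ , ∉⊥) answer
    where
    answer : ∀ x → Free ⊥ ⊥ x → DTurn (Cycle n) (suc m) ⊥ (⊥ ∪ ⁅ x ⁆)
    answer x _ = d-move (vtx (suc (toℕ x))) (∉⊥ , ∉-∪⁅⁆ ∉⊥ successor≢x)
      (holding-vtx-wins m (suc (toℕ x)) (toℕ<n x) (subst (2 + (m + m) ≤_) (sym n≡3+2m) (n≤1+n _))
                       (≤-reflexive n≡3+2m) (λ t<2m → ∉-∪⁅⁆ ∉⊥ (pair-vertex≢x t<2m)))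
      where
      x+≢x : ∀ {d} → 0 < d → d < n → vtx (toℕ x + d) ≢ x
      x+≢x 0<d d<n eq = vtx-+-≢ (toℕ x) 0<d d<n (trans eq (sym (vtx-toℕ x)))
      successor≢x : vtx (suc (toℕ x)) ≢ x
      successor≢x eq = x+≢x (s≤s z≤n) (subst (1 <_) (sym n≡3+2m) (s≤s (s≤s z≤n)))
                            (trans (cong vtx (+-comm (toℕ x) 1)) eq)
      pair-vertex≢x : ∀ {t} → t < m + m → vtx (3 + toℕ x + t) ≢ x
      pair-vertex≢x {t} t<2m eq =
        x+≢x (s≤s z≤n) (subst (3 + t <_) (sym n≡3+2m) (s≤s (s≤s (s≤s t<2m))))
             (trans (cong vtx (trans (sym (+-assoc (toℕ x) 3 t)) (cong (_+ t) (+-comm (toℕ x) 3)))) eq)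

-- offsets-parity holds by the parity of n when n is even (the last pair wraps
-- around) and by injectivity of offsets below n when n is odd.
module StaggeredPairs (n : ℕ) .{{_ : NonZero n}} (h : ℕ) (h+h≤n : h + h ≤ n)
  (offsets-parity : ∀ {e e′ i j} → e ≤ 3 → e′ ≤ 3 → i < h → j < h →
                    CycleArithmetic.vtx n (e + (i + i)) ≡ CycleArithmetic.vtx n (e′ + (j + j)) →
                    e % 2 ≡ e′ % 2)
  where
  open CycleArithmetic n

  private
    i+i<n : ∀ {i} → i < h → i + i < n
    i+i<n i<h = ≤-trans (≤-trans (n≤1+n _) (2+i+i≤p+p i<h)) h+h≤n

    same-offset : ∀ e {i j} → i < h → j < h → vtx (e + (i + i)) ≡ vtx (e + (j + j)) → i ≡ j
    same-offset e i<h j<h eq = i+i-injective (vtx-injective e (i+i<n i<h) (i+i<n j<h) eq)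

  pairing : Pairing n
  pairing = record
    { size     = h
    ; pair     = λ i → vtx (i + i) , vtx (3 + (i + i))
    ; distinct = λ i<h eq → 0≢1+n (offsets-parity {0} {3} z≤n ≤-refl i<h i<h eq)
    ; disjoint = disjoint
    }
    where
    disjoint : ∀ {i j x} → i < h → j < h → x ∈ₚ (vtx (i + i) , vtx (3 + (i + i))) →
               x ∈ₚ (vtx (j + j) , vtx (3 + (j + j))) → i ≡ j
    disjoint i<h j<h (inj₁ refl) (inj₁ eq) = same-offset 0 i<h j<h eq
    disjoint i<h j<h (inj₂ refl) (inj₂ eq) = same-offset 3 i<h j<h eq
    disjoint i<h j<h (inj₁ refl) (inj₂ eq) =
      ⊥-elim (0≢1+n (offsets-parity {0} {3} z≤n ≤-refl i<h j<h eq))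
    disjoint i<h j<h (inj₂ refl) (inj₁ eq) =
      ⊥-elim (0≢1+n (offsets-parity {0} {3} z≤n ≤-refl j<h i<h (sym eq)))

  block : ℕ → List (Fin n)
  block i = vtx (1 + (i + i)) ∷ vtx (2 + (i + i)) ∷ []

  blocks-disjoint : ∀ {i j x} → i < h → j < h → x ∈ˡ block i → x ∈ˡ block j → i ≡ j
  blocks-disjoint i<h j<h (here refl) (here eq) = same-offset 1 i<h j<h eq
  blocks-disjoint i<h j<h (there (here refl)) (there (here eq)) = same-offset 2 i<h j<h eq
  blocks-disjoint i<h j<h (here refl) (there (here eq)) =
    ⊥-elim (1+n≢0 (offsets-parity {1} {2} (s≤s z≤n) (s≤s (s≤s z≤n)) i<h j<h eq))
  blocks-disjoint i<h j<h (there (here refl)) (here eq) =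
    ⊥-elim (1+n≢0 (offsets-parity {1} {2} (s≤s z≤n) (s≤s (s≤s z≤n)) j<h i<h (sym eq)))

  blocks-hit : ∀ {D} → Dominating (Cycle n) D → Pairing.NoPairIn pairing D →
               ∀ {i} → i < h → Any (_∈ D) (block i)
  blocks-hit dom no-pair {i} i<h = middle-hit (i + i) dom (no-pair i<h)

module CycleLowerBounds (n : ℕ) .{{_ : NonZero n}} where
  open CycleArithmetic n

  module Even (h : ℕ) (n≡h+h : n ≡ h + h) where
    offsets-parity : ∀ {e e′ i j} → e ≤ 3 → e′ ≤ 3 → i < h → j < h →
                     vtx (e + (i + i)) ≡ vtx (e′ + (j + j)) → e % 2 ≡ e′ % 2
    offsets-parity {e} {e′} {i} {j} _ _ _ _ eq =
      trans (sym ([m+[i+i]]%2≡m%2 e i)) (trans (vtx-≡⇒%2≡ {h} n≡h+h eq) ([m+[i+i]]%2≡m%2 e′ j))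

    open StaggeredPairs n h (≤-reflexive (sym n≡h+h)) offsets-parity
    open StallerPairingStrategy (Cycle n) pairing h block blocks-disjoint blocks-hit public
      using (γ-lower; γ′-lower)

  module Odd (m : ℕ) (n≡3+2m : n ≡ 3 + (m + m)) where
    offset< : ∀ {e i} → e ≤ 3 → i < m → e + (i + i) < n
    offset< {e} {i} e≤3 i<m =
      subst (e + (i + i) <_) (sym n≡3+2m) (+-mono-≤-< e≤3 (<-trans (n<1+n _) (2+i+i≤p+p i<m)))

    offsets-parity : ∀ {e e′ i j} → e ≤ 3 → e′ ≤ 3 → i < m → j < m →
                     vtx (e + (i + i)) ≡ vtx (e′ + (j + j)) → e % 2 ≡ e′ % 2
    offsets-parity {e} {e′} {i} {j} e≤3 e′≤3 i<m j<m eq =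
      trans (sym ([m+[i+i]]%2≡m%2 e i))
            (trans (cong (_% 2) (vtx-injective 0 (offset< e≤3 i<m) (offset< e′≤3 j<m) eq))
                   ([m+[i+i]]%2≡m%2 e′ j))

    open StaggeredPairs n m (subst (m + m ≤_) (sym n≡3+2m) (m≤n+m (m + m) 3)) offsets-parity

    -- Block 0 is the closed neighbourhood of vertex n − 1 = 2 + 2m.
    block′ : ℕ → List (Fin n)
    block′ zero = vtx (1 + (m + m)) ∷ vtx (2 + (m + m)) ∷ vtx (3 + (m + m)) ∷ []
    block′ (suc i) = block i

    block-range : ∀ {i x} → i < m → x ∈ˡ block i → 0 < toℕ x × toℕ x ≤ m + m
    block-range i<m (here refl) rewrite toℕ-vtx-< (offset< (s≤s z≤n) i<m) =
      s≤s z≤n , ≤-trans (n≤1+n _) (2+i+i≤p+p i<m)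
    block-range i<m (there (here refl)) rewrite toℕ-vtx-< (offset< (s≤s (s≤s z≤n)) i<m) =
      s≤s z≤n , 2+i+i≤p+p i<m

    neighbourhood-range : ∀ {x} → x ∈ˡ block′ zero → toℕ x ≡ 0 ⊎ m + m < toℕ x
    neighbourhood-range (here refl)
      rewrite toℕ-vtx-< {1 + (m + m)} (subst (_ <_) (sym n≡3+2m) (s≤s (n≤1+n _))) =
      inj₂ ≤-refl
    neighbourhood-range (there (here refl))
      rewrite toℕ-vtx-< {2 + (m + m)} (subst (_ <_) (sym n≡3+2m) ≤-refl) =
      inj₂ (n≤1+n _)
    neighbourhood-range (there (there (here refl))) =
      inj₁ (trans (cong toℕ (trans (cong vtx (sym n≡3+2m)) (vtx-+n 0))) (toℕ-vtx-< (>-nonZero⁻¹ n)))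

    neighbourhood-apart : ∀ {i x} → i < m → x ∈ˡ block′ zero → ¬ x ∈ˡ block i
    neighbourhood-apart i<m x∈N x∈i with neighbourhood-range x∈N | block-range i<m x∈i
    ... | inj₁ x≡0 | 0<x , _ = <-irrefl (sym x≡0) 0<x
    ... | inj₂ 2m<x | _ , x≤2m = <⇒≱ 2m<x x≤2m

    blocks-disjoint′ : ∀ {i j x} → i < suc m → j < suc m → x ∈ˡ block′ i → x ∈ˡ block′ j → i ≡ j
    blocks-disjoint′ {zero} {zero} _ _ _ _ = refl
    blocks-disjoint′ {zero} {suc j} _ 1+j<1+m x∈N x∈j =
      ⊥-elim (neighbourhood-apart (≤-pred 1+j<1+m) x∈N x∈j)
    blocks-disjoint′ {suc i} {zero} 1+i<1+m _ x∈i x∈N =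
      ⊥-elim (neighbourhood-apart (≤-pred 1+i<1+m) x∈N x∈i)
    blocks-disjoint′ {suc i} {suc j} 1+i<1+m 1+j<1+m x∈i x∈j =
      cong suc (blocks-disjoint (≤-pred 1+i<1+m) (≤-pred 1+j<1+m) x∈i x∈j)

    blocks-hit′ : ∀ {D} → Dominating (Cycle n) D → Pairing.NoPairIn pairing D →
                  ∀ {i} → i < suc m → Any (_∈ D) (block′ i)
    blocks-hit′ dom _ {zero} _ = neighbourhood-hit (1 + (m + m)) dom
    blocks-hit′ dom no-pair {suc i} 1+i<1+m = blocks-hit dom no-pair (≤-pred 1+i<1+m)

    open StallerPairingStrategy (Cycle n) pairing (suc m) block′ blocks-disjoint′ blocks-hit′ public
      using (γ-lower; γ′-lower)

module _ (n : ℕ) .{{_ : NonZero n}} where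
  open CycleUpperBounds n
  open CycleLowerBounds n

  γ-cycle-even : ∀ m → n ≡ suc m + suc m → γMB≡ (Cycle n) (suc m) × γMB'≡ (Cycle n) (suc m)
  γ-cycle-even m even =
      (γ-upper m (≤-reflexive (sym n≡2+2m)) (≤-trans (≤-reflexive n≡2+2m) (n≤1+n _))
      , λ _ → Even.γ-lower (suc m) even)
    , (γ′-upper-even (suc m) even , λ _ → Even.γ′-lower (suc m) even)
    where
    n≡2+2m : n ≡ 2 + (m + m)
    n≡2+2m = trans even (cong suc (+-suc m m))

  γ-cycle-odd : ∀ m → n ≡ suc (suc m + suc m) → γMB≡ (Cycle n) (suc m) × γMB'≡ (Cycle n) (suc m)
  γ-cycle-odd m odd =
      (γ-upper m (subst (2 + (m + m) ≤_) (sym n≡3+2m) (n≤1+n _)) (≤-reflexive n≡3+2m)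
      , λ _ → Odd.γ-lower m n≡3+2m)
    , (γ′-upper-odd m n≡3+2m , λ _ → Odd.γ′-lower m n≡3+2m)
    where
    n≡3+2m : n ≡ 3 + (m + m)
    n≡3+2m = trans odd (cong (suc ∘ suc) (+-suc m m))

theorem5p1 : ∀ (n : ℕ) → 3 ≤ n →
    γMB≡ (Cycle n) (n / 2) × γMB'≡ (Cycle n) (n / 2)
theorem5p1 n@(suc (suc (suc _))) _ with n / 2 | parity n
... | zero | inj₁ ()
... | zero | inj₂ ()
... | suc m | inj₁ even = γ-cycle-even n m even
... | suc m | inj₂ odd = γ-cycle-odd n m odd
theorem5p1 1 (s≤s ())
theorem5p1 2 (s≤s (s≤s ()))
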